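{- Let $T[1,n]$ be a string, $\epsilon>0$, and let $\mathcal{G}(T)$ be the weighted DAG with vertices $v_1,\dots,v_{n+1}$ and an edge $(v_i,v_j)$ for each $1\le i<j\le n+1$ of cost $c(v_i,v_j)=|\mathcal{C}(T[i,j-1])|$, the length in bits of the compression of $T[i,j-1]$ by the base compressor $\mathcal{C}$, which is assumed to satisfy the monotonicity assumption in the context. Let $\mathcal{G}_\epsilon(T)$ be the subgraph of $\mathcal{G}(T)$ on the same vertices containing exactly those edges $(v_i,v_j)$, $i<j$, such that either (a) there is a positive integer $k$ with $c(v_i,v_j)\le(1+\epsilon)^k<c(v_i,v_{j+1})$, or (b) $j=n+1$. Then the shortest path in $\mathcal{G}_\epsilon(T)$ from $v_1$ to $v_{n+1}$ has total cost at most $(1+\epsilon)\,d_{\mathcal{G}(T)}(v_1,v_{n+1})$, where $d_{\mathcal{G}(T)}$ is the shortest-path distance in $\mathcal{G}(T)$.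
   Context: $\mathcal{C}$ produces prefix-free encodings, so compressed sizes are positive integers (numbers of bits). Paths from $v_1$ to $v_{n+1}$ in $\mathcal{G}(T)$ correspond one-to-one to partitions of $T$ into contiguous substrings (edge $(v_i,v_j)$ corresponds to the part $T[i,j-1]$), and the cost of a path equals the total compressed size of the corresponding partition. The paper assumes monotone costs: $0<c(v_i,v_{i+1})\le c(v_i,v_{i+2})\le\dots\le c(v_i,v_{n+1})$ for every $i$, and more generally the compressed size of a substring of $T$ is at most that of any substring of $T$ containing it.
   Formalization: The approximation parameter ε ranges over the positive rationals. -}

module Defs where

open import Data.Nat as ℕ using (ℕ; zero; suc; _∸_)
open import Data.Integer using (+_)
open import Data.Rational as ℚ using (ℚ; 1ℚ; _/_)
open import Data.List using (List; length; take; drop)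
open import Data.Bool using (Bool)
open import Data.Unit using (⊤)
open import Data.Product using (∃; _×_)
open import Data.Sum using (_⊎_)
open import Relation.Binary.PropositionalEquality using (_≡_)

ℕ→ℚ : ℕ → ℚ
ℕ→ℚ n = + n / 1

_^ℚ_ : ℚ → ℕ → ℚ
q ^ℚ zero  = 1ℚ
q ^ℚ suc k = q ℚ.* (q ^ℚ k)

-- Vertices are 0,…,n (0-based: vertex i here is v_{i+1} of the paper).
-- The edge (i , j), i < j, corresponds to the substring T[i .. j-1] (0-based),
-- i.e. the paper's T[i+1, j].
slice : {A : Set} → List A → ℕ → ℕ → List A
slice T i j = take (j ∸ i) (drop i T)

cost : {A : Set} → (List A → List Bool) → List A → ℕ → ℕ → ℕ
cost C T i j = length (C (slice T i j))

data Path (E : ℕ → ℕ → Set) : ℕ → ℕ → Set where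
  stop : ∀ {i} → Path E i i
  step : ∀ {i j k} → i ℕ.< j → E i j → Path E j k → Path E i k

pathCost : ∀ {E i k} → (ℕ → ℕ → ℕ) → Path E i k → ℕ
pathCost c stop = 0
pathCost c (step {i} {j} _ _ p) = c i j ℕ.+ pathCost c p

-- Edge predicate of the full graph G(T): every pair i < j is an edge
-- (j ≤ n is enforced by the path ending at n and being increasing).
AllEdges : ℕ → ℕ → Set
AllEdges _ _ = ⊤

EpsEdge : (c : ℕ → ℕ → ℕ) (n : ℕ) (ε : ℚ) → ℕ → ℕ → Set
EpsEdge c n ε i j =
  (∃ λ k → 1 ℕ.≤ k
     × ℕ→ℚ (c i j) ℚ.≤ ((1ℚ ℚ.+ ε) ^ℚ k)
     × ((1ℚ ℚ.+ ε) ^ℚ k) ℚ.< ℕ→ℚ (c i (suc j)))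
  ⊎ j ≡ n

IsShortest : ∀ {E i k} → (ℕ → ℕ → ℕ) → Path E i k → Set
IsShortest {E} {i} {k} c P = (P′ : Path E i k) → pathCost c P ℕ.≤ pathCost c P′

-- Fix ε > 0 and write q = 1 + ε. Every edge (vᵢ, vₘ) of 𝒢(T) is dominated by an edge
-- (vᵢ, v_m′) of 𝒢_ε(T) with m′ ≥ m and c(vᵢ, v_m′) ≤ q · c(vᵢ, vₘ): choose k ≥ 1 with
-- c(vᵢ, vₘ) ≤ qᵏ ≤ q · c(vᵢ, vₘ) and let m′ be the last vertex with c(vᵢ, v_m′) ≤ qᵏ.
-- Following an arbitrary path of 𝒢(T) and replacing each edge by its dominating edge
-- (starting from the current vertex, which only lowers the cost by monotonicity) yields a
-- path of 𝒢_ε(T) at most q times as expensive.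
module Submission where

open import Defs
open import Data.Nat as ℕ using (ℕ; _≤_; _<_)
open import Data.Rational as ℚ using (ℚ; 0ℚ; 1ℚ)
open import Data.List using (List; length)
open import Data.Bool using (Bool)

open import Data.Nat using (zero; suc; z≤n; s≤s; _≤′_; ≤′-refl; ≤′-step)
open import Data.Nat.Properties as ℕ
  using (≤⇒≤′; m≤n⇒m≤1+n; n≤1+n; m≤n+m; <-≤-trans; ≰⇒>; _≤?_)
open import Data.Nat.Coprimality as Coprime using (1-coprimeTo)
open import Data.Integer as ℤ using (+_; +[1+_])
import Data.Integer.Properties as ℤ
open import Data.Rational using (mkℚ; toℚᵘ; NonNegative; Positive)
open import Data.Rational.Properties as ℚ
  using (≤-trans; ≤-reflexive; <⇒≤; *-monoˡ-≤-nonNeg; *-cancelˡ-<-nonNeg; +-mono-≤)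
import Data.Rational.Unnormalised as ℚᵘ
import Data.Rational.Unnormalised.Properties as ℚᵘ
open import Data.Rational.Solver using (module +-*-Solver)
open import Data.Product using (Σ; ∃; _×_; _,_)
open import Data.Sum using (_⊎_; inj₁; inj₂)
open import Relation.Nullary using (¬_; yes; no)
open import Relation.Unary using (Pred; Decidable)
open import Relation.Binary.PropositionalEquality using (_≡_; refl; sym; trans; cong; subst₂)

ℕ→ℚ≡mkℚ : ∀ n → ℕ→ℚ n ≡ mkℚ (+ n) 0 (Coprime.sym (1-coprimeTo n))
ℕ→ℚ≡mkℚ n = ℚ.normalize-coprime _

ℕ→ℚ-mono-≤ : ∀ {m n} → m ≤ n → ℕ→ℚ m ℚ.≤ ℕ→ℚ n
ℕ→ℚ-mono-≤ {m} {n} m≤n rewrite ℕ→ℚ≡mkℚ m | ℕ→ℚ≡mkℚ n =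
  ℚ.*≤* (subst₂ ℤ._≤_ (sym (ℤ.*-identityʳ (+ m))) (sym (ℤ.*-identityʳ (+ n))) (ℤ.+≤+ m≤n))

ℕ→ℚ-homo-+ : ∀ m n → ℕ→ℚ (m ℕ.+ n) ≡ ℕ→ℚ m ℚ.+ ℕ→ℚ n
ℕ→ℚ-homo-+ m n
  rewrite ℕ→ℚ≡mkℚ m | ℕ→ℚ≡mkℚ n | ℤ.*-identityʳ (+ m) | ℤ.*-identityʳ (+ n) = refl

-- For ε = (1 + p) / (1 + d) the witness is N = a (1 + d), so that N ε = a (1 + p).
archimedean : ∀ ε → .{{Positive ε}} → ∀ a → ∃ λ N → ℕ→ℚ a ℚ.≤ ℕ→ℚ N ℚ.* ε
archimedean ε@(mkℚ +[1+ p ] d _) a =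
  N , ℚ.toℚᵘ-cancel-≤ (ℚᵘ.≤-respʳ-≃ (ℚᵘ.≃-sym (ℚ.toℚᵘ-homo-* (ℕ→ℚ N) ε)) a≤Nε)
  where
  N = a ℕ.* suc d
  a≤Nε : toℚᵘ (ℕ→ℚ a) ℚᵘ.≤ toℚᵘ (ℕ→ℚ N) ℚᵘ.* toℚᵘ ε
  a≤Nε rewrite ℕ→ℚ≡mkℚ a | ℕ→ℚ≡mkℚ N =
    ℚᵘ.*≤* (subst₂ ℤ._≤_
      (trans (cong (λ z → + (a ℕ.* suc z)) (sym (ℕ.+-identityʳ d))) (ℤ.pos-* a (suc (d ℕ.+ 0))))
      (trans (ℤ.pos-* N (suc p)) (sym (ℤ.*-identityʳ _)))
      (ℤ.+≤+ (ℕ.m≤m*n N (suc p))))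

end-of-run : ∀ {ℓ} {P : Pred ℕ ℓ} → Decidable P → ∀ {m n} → m ≤ n → P m →
  ∃ λ k → m ≤ k × k ≤ n × P k × (k ≡ n ⊎ ¬ P (suc k))
end-of-run {P = P} P? {m} m≤n Pm = go (≤⇒≤′ m≤n)
  where
  go : ∀ {n} → m ≤′ n → ∃ λ k → m ≤ k × k ≤ n × P k × (k ≡ n ⊎ ¬ P (suc k))
  go ≤′-refl = m , ℕ.≤-refl , ℕ.≤-refl , Pm , inj₁ refl
  go (≤′-step m≤′n) with go m≤′n
  ... | k , m≤k , k≤n , Pk , inj₂ ¬Pk+1 = k , m≤k , m≤n⇒m≤1+n k≤n , Pk , inj₂ ¬Pk+1
  ... | k , m≤k , _ , Pk , inj₁ refl with P? (suc k)
  ...   | yes Pk+1 = suc k , m≤n⇒m≤1+n m≤k , ℕ.≤-refl , Pk+1 , inj₁ refl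
  ...   | no ¬Pk+1 = k , m≤k , n≤1+n k , Pk , inj₂ ¬Pk+1

module Powers (ε : ℚ) {{ε≥0 : NonNegative ε}} where
  open +-*-Solver

  q : ℚ
  q = 1ℚ ℚ.+ ε

  instance
    q≥0 : NonNegative q
    q≥0 = ℚ.nonNeg+nonNeg⇒nonNeg 1ℚ ε

  x≤qx : ∀ {x} → 0ℚ ℚ.≤ x → x ℚ.≤ q ℚ.* x
  x≤qx {x} 0≤x = begin
    x               ≡⟨ sym (ℚ.+-identityʳ x) ⟩
    x ℚ.+ 0ℚ        ≡⟨ cong (x ℚ.+_) (sym (ℚ.*-zeroʳ ε)) ⟩
    x ℚ.+ ε ℚ.* 0ℚ  ≤⟨ ℚ.+-monoʳ-≤ x (*-monoˡ-≤-nonNeg ε 0≤x) ⟩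
    x ℚ.+ ε ℚ.* x   ≡⟨ solve 2 (λ x e → x :+ e :* x := (con 1ℚ :+ e) :* x) refl x ε ⟩
    q ℚ.* x         ∎
    where open ℚ.≤-Reasoning

  1≤q^ : ∀ k → 1ℚ ℚ.≤ q ^ℚ k
  1≤q^ zero    = ℚ.≤-refl
  1≤q^ (suc k) = ≤-trans (1≤q^ k) (x≤qx (≤-trans (ℚ.nonNegative⁻¹ 1ℚ) (1≤q^ k)))

  q^≤q^suc : ∀ k → q ^ℚ k ℚ.≤ q ^ℚ suc k
  q^≤q^suc k = x≤qx (≤-trans (ℚ.nonNegative⁻¹ 1ℚ) (1≤q^ k))

  bernoulli : ∀ N → ℕ→ℚ N ℚ.* ε ℚ.≤ q ^ℚ N
  bernoulli zero    = ≤-trans (≤-reflexive (ℚ.*-zeroˡ ε)) (ℚ.nonNegative⁻¹ 1ℚ)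
  bernoulli (suc N) = begin
    ℕ→ℚ (suc N) ℚ.* ε             ≡⟨ cong (ℚ._* ε) (ℕ→ℚ-homo-+ 1 N) ⟩
    (1ℚ ℚ.+ ℕ→ℚ N) ℚ.* ε          ≡⟨ solve 2 (λ e n → (con 1ℚ :+ n) :* e := e :* con 1ℚ :+ n :* e) refl ε (ℕ→ℚ N) ⟩
    ε ℚ.* 1ℚ ℚ.+ ℕ→ℚ N ℚ.* ε      ≤⟨ +-mono-≤ (*-monoˡ-≤-nonNeg ε (1≤q^ N)) (bernoulli N) ⟩
    ε ℚ.* q ^ℚ N ℚ.+ q ^ℚ N       ≡⟨ solve 2 (λ e y → e :* y :+ y := (con 1ℚ :+ e) :* y) refl ε (q ^ℚ N) ⟩
    q ^ℚ suc N                    ∎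
    where open ℚ.≤-Reasoning

  -- k is the last exponent with qᵏ ≤ q a, searched for below an N with a ≤ q^N.
  power-bracket : {{Positive ε}} → ∀ a → 1 ≤ a →
    ∃ λ k → 1 ≤ k × ℕ→ℚ a ℚ.≤ q ^ℚ k × q ^ℚ k ℚ.≤ q ℚ.* ℕ→ℚ a
  power-bracket a 1≤a with archimedean ε a
  ... | N , a≤Nε
    with end-of-run (λ k → q ^ℚ k ℚ.≤? q ℚ.* ℕ→ℚ a) {n = suc N} (s≤s z≤n)
                    (*-monoˡ-≤-nonNeg q (ℕ→ℚ-mono-≤ 1≤a))
  ...   | k , 1≤k , _ , qᵏ≤qa , inj₁ refl =
          k , 1≤k , ≤-trans a≤Nε (≤-trans (bernoulli N) (q^≤q^suc N)) , qᵏ≤qa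
  ...   | k , 1≤k , _ , qᵏ≤qa , inj₂ qᵏ⁺¹≰qa =
          k , 1≤k , <⇒≤ (*-cancelˡ-<-nonNeg q (ℚ.≰⇒> qᵏ⁺¹≰qa)) , qᵏ≤qa

Covers : (ℕ → ℕ → ℕ) → ℕ → ℚ → (ℕ → ℕ → Set) → Set
Covers c n q E = ∀ i m → i < m → m ≤ n →
  ∃ λ m′ → m ≤ m′ × m′ ≤ n × E i m′ × ℕ→ℚ (c i m′) ℚ.≤ q ℚ.* ℕ→ℚ (c i m)

EpsEdge-covers : ∀ (c : ℕ → ℕ → ℕ) n ε {{_ : Positive ε}} →
  (∀ i m → i < m → m ≤ n → 0 < c i m) →
  Covers c n (1ℚ ℚ.+ ε) (EpsEdge c n ε)
EpsEdge-covers c n ε {{ε>0}} pos i m i<m m≤n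
  with power-bracket (c i m) (pos i m i<m m≤n)
  where open Powers ε {{ℚ.pos⇒nonNeg ε}}
... | k , 1≤k , cᵢₘ≤qᵏ , qᵏ≤qcᵢₘ
  with end-of-run (λ m′ → ℕ→ℚ (c i m′) ℚ.≤? (1ℚ ℚ.+ ε) ^ℚ k) m≤n cᵢₘ≤qᵏ
... | m′ , m≤m′ , m′≤n , cᵢₘ′≤qᵏ , inj₁ refl =
      m′ , m≤m′ , m′≤n , inj₂ refl , ≤-trans cᵢₘ′≤qᵏ qᵏ≤qcᵢₘ
... | m′ , m≤m′ , m′≤n , cᵢₘ′≤qᵏ , inj₂ cᵢₘ′₊₁≰qᵏ =
      m′ , m≤m′ , m′≤n , inj₁ (k , 1≤k , cᵢₘ′≤qᵏ , ℚ.≰⇒> cᵢₘ′₊₁≰qᵏ) , ≤-trans cᵢₘ′≤qᵏ qᵏ≤qcᵢₘ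

path⇒≤ : ∀ {E i k} → Path E i k → i ≤ k
path⇒≤ stop            = ℕ.≤-refl
path⇒≤ (step i<j _ p) = ℕ.≤-trans (ℕ.<⇒≤ i<j) (path⇒≤ p)

module _ {c : ℕ → ℕ → ℕ} {n : ℕ} {q : ℚ} {{_ : NonNegative q}} {E : ℕ → ℕ → Set}
  (covers : Covers c n q E)
  (suffix-mono : ∀ j i m → j ≤ i → i < m → m ≤ n → c i m ≤ c j m)
  where

  -- The constructed path starts at some vertex i ≥ j, i.e. it may be ahead of Q.
  covering-path : ∀ {E′ j} (Q : Path E′ j n) i → j ≤ i → i ≤ n →
    Σ (Path E i n) λ P → ℕ→ℚ (pathCost c P) ℚ.≤ q ℚ.* ℕ→ℚ (pathCost c Q)
  covering-path stop i j≤i i≤n rewrite ℕ.≤-antisym i≤n j≤i =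
    stop , ≤-reflexive (sym (ℚ.*-zeroʳ q))
  covering-path (step {j} {m} _ _ Q) i j≤i i≤n with m ≤? i
  ... | yes m≤i with covering-path Q i m≤i i≤n
  ...   | P , P≤qQ = P , ≤-trans P≤qQ (*-monoˡ-≤-nonNeg q (ℕ→ℚ-mono-≤ (m≤n+m _ (c j m))))
  covering-path (step {j} {m} _ _ Q) i j≤i i≤n | no m≰i
    with covers i m (≰⇒> m≰i) (path⇒≤ Q)
  ... | m′ , m≤m′ , m′≤n , e , cᵢₘ′≤qcᵢₘ with covering-path Q m′ m≤m′ m′≤n
  ...   | P , P≤qQ = step (<-≤-trans i<m m≤m′) e P , P≤qQ′
    where
    i<m = ≰⇒> m≰i
    cᵢₘ′≤qcⱼₘ : ℕ→ℚ (c i m′) ℚ.≤ q ℚ.* ℕ→ℚ (c j m)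
    cᵢₘ′≤qcⱼₘ = ≤-trans cᵢₘ′≤qcᵢₘ
      (*-monoˡ-≤-nonNeg q (ℕ→ℚ-mono-≤ (suffix-mono j i m j≤i i<m (path⇒≤ Q))))
    open ℚ.≤-Reasoning
    P≤qQ′ : ℕ→ℚ (c i m′ ℕ.+ pathCost c P) ℚ.≤ q ℚ.* ℕ→ℚ (c j m ℕ.+ pathCost c Q)
    P≤qQ′ = begin
      ℕ→ℚ (c i m′ ℕ.+ pathCost c P)                   ≡⟨ ℕ→ℚ-homo-+ (c i m′) _ ⟩
      ℕ→ℚ (c i m′) ℚ.+ ℕ→ℚ (pathCost c P)             ≤⟨ +-mono-≤ cᵢₘ′≤qcⱼₘ P≤qQ ⟩
      q ℚ.* ℕ→ℚ (c j m) ℚ.+ q ℚ.* ℕ→ℚ (pathCost c Q)  ≡⟨ sym (ℚ.*-distribˡ-+ q _ _) ⟩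
      q ℚ.* (ℕ→ℚ (c j m) ℚ.+ ℕ→ℚ (pathCost c Q))      ≡⟨ cong (q ℚ.*_) (sym (ℕ→ℚ-homo-+ (c j m) _)) ⟩
      q ℚ.* ℕ→ℚ (c j m ℕ.+ pathCost c Q)              ∎

theorem1 : {A : Set} (C : List A → List Bool) (T : List A) (ε : ℚ) →
    0ℚ ℚ.< ε →
    (∀ i j → i < j → j ≤ length T → 0 < cost C T i j) →
    (∀ i i′ j′ j → i ≤ i′ → i′ < j′ → j′ ≤ j → j ≤ length T →
       cost C T i′ j′ ≤ cost C T i j) →
    (P : Path (EpsEdge (cost C T) (length T) ε) 0 (length T)) →
    IsShortest (cost C T) P →
    (Q : Path AllEdges 0 (length T)) →
    ℕ→ℚ (pathCost (cost C T) P) ℚ.≤ (1ℚ ℚ.+ ε) ℚ.* ℕ→ℚ (pathCost (cost C T) Q)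
theorem1 C T ε ε>0 pos mono P P-shortest Q =
  let (P′ , P′≤qQ) = covering in ≤-trans (ℕ→ℚ-mono-≤ (P-shortest P′)) P′≤qQ
  where
  instance
    ε-pos : Positive ε
    ε-pos = ℚ.positive ε>0
    q≥0 : NonNegative (1ℚ ℚ.+ ε)
    q≥0 = Powers.q≥0 ε {{ℚ.pos⇒nonNeg ε}}

  suffix-mono : ∀ j i m → j ≤ i → i < m → m ≤ length T → cost C T i m ≤ cost C T j m
  suffix-mono j i m j≤i i<m = mono j i m m j≤i i<m ℕ.≤-refl

  covering : Σ (Path (EpsEdge (cost C T) (length T) ε) 0 (length T)) λ P′ →
    ℕ→ℚ (pathCost (cost C T) P′) ℚ.≤ (1ℚ ℚ.+ ε) ℚ.* ℕ→ℚ (pathCost (cost C T) Q)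
  covering = covering-path {q = 1ℚ ℚ.+ ε} (EpsEdge-covers (cost C T) (length T) ε pos) suffix-mono
    Q 0 z≤n z≤n
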